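{- Let $G$ be an $r$-regular finite simple graph on $n$ vertices and let $k$ be an integer with $0\le k<r$. Let $\alpha_k(G)$ denote the maximum number of vertices of an induced subgraph of $G$ that is $k$-degenerate. Then $$\frac{(k+1)n}{r+1}\le \alpha_k(G)\le \frac{rn-2k}{2r-2k}.$$
   Context: A graph is $k$-degenerate if every subgraph of it has a vertex of degree at most $k$; equivalently, its vertices can be ordered $v_1,\dots,v_h$ so that each $v_i$ has at most $k$ neighbors among $v_1,\dots,v_{i-1}$. -}

module Defs where

open import Data.Nat using (ℕ; _≤_)
open import Data.Bool using (Bool; true; false; T)
open import Data.Fin using (Fin)
open import Data.Fin.Subset using (Subset; _∈_; _⊆_; ∣_∣; Nonempty; _∩_)
open import Data.Vec using (Vec; tabulate)
open import Data.Product using (∃; _×_)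
open import Relation.Binary.PropositionalEquality using (_≡_)

record SimpleGraph (n : ℕ) : Set where
  field
    adj     : Fin n → Fin n → Bool
    symm    : ∀ u v → adj u v ≡ adj v u
    irrefl  : ∀ v → adj v v ≡ false

open SimpleGraph public

N : ∀ {n} → SimpleGraph n → Fin n → Subset n
N G v = tabulate (adj G v)

degree : ∀ {n} → SimpleGraph n → Fin n → ℕ
degree G v = ∣ N G v ∣

Regular : ∀ {n} → ℕ → SimpleGraph n → Set
Regular r G = ∀ v → degree G v ≡ r

InducedDegenerate : {n : ℕ} → ℕ → SimpleGraph n → Subset n → Set
InducedDegenerate {n} k G S =
  ∀ (T : Subset n) → T ⊆ S → Nonempty T →
  ∃ λ v → v ∈ T × ∣ N G v ∩ T ∣ ≤ k

-- Upper bound: a k-degenerate graph on s ≥ 1 vertices has at most k(s − 1) edges, so at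
-- most 2k(s − 1) of the rs edge-ends at a k-degenerate S stay inside S; the others lead to
-- the n − s vertices outside S, which can absorb at most r(n − s) of them.
--
-- Lower bound: weigh each vertex of the current induced subgraph by (k+1)/(max(d,k)+1),
-- d its current degree. If some vertex has degree ≤ k, move it into S and delete it: the
-- total weight drops by at most its own weight 1, since deletions only raise weights. Otherwise
-- delete a vertex of maximum degree Δ: it takes away (k+1)/(Δ+1), but each of its Δ
-- neighbours gains at least (k+1)/Δ − (k+1)/(Δ+1). Hence |S| is at least the initial total
-- weight n(k+1)/(r+1), and S is k-degenerate because every vertex of S has at most k
-- neighbours among the vertices put into S after it.

module Submission where

open import Algebra.Properties.CommutativeSemigroup as CommSemigroup using ()
open import Data.Bool.Base using (Bool; true; false)
open import Data.Fin.Base using (Fin; zero; suc; fromℕ<)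
open import Data.Fin.Properties using (any?)
open import Data.Fin.Subset
open import Data.Fin.Subset.Induction using (Acc; acc; ⊂-wellFounded)
open import Data.Fin.Subset.Properties
open import Data.Nat.Base hiding (∣_-_∣)
open import Data.Nat.DivMod using (_/_; m/n*n≡m; /-monoʳ-≤)
open import Data.Nat.Divisibility using (divides; ∣-trans; m∣m*n; m≤n⇒m!∣n!)
open import Data.Nat.Properties
open import Data.Nat.Tactic.RingSolver using (solve-∀)
open import Data.Product.Base using (∃; _×_; _,_)
open import Data.Sum.Base using (inj₁; inj₂)
open import Data.Vec.Base using ([]; _∷_; lookup; here; there)
open import Data.Vec.Properties using (lookup∘tabulate; []=⇒lookup)
open import Relation.Binary.PropositionalEquality
open import Relation.Nullary using (yes; no; contradiction)
open import Relation.Nullary.Decidable using (_×-dec_)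

open import Defs

open CommSemigroup +-commutativeSemigroup using (interchange; x∙yz≈y∙xz)
open CommSemigroup *-commutativeSemigroup using () renaming (x∙yz≈y∙xz to x*yz≡y*xz)

private
  variable
    n : ℕ
    p : Subset n
    f g : Fin n → ℕ
    x : Fin n

∑ : Subset n → (Fin n → ℕ) → ℕ
∑ []            f = 0
∑ (inside  ∷ p) f = f zero + ∑ p (λ x → f (suc x))
∑ (outside ∷ p) f = ∑ p (λ x → f (suc x))

syntax ∑ p (λ x → e) = ∑[ x ∈ p ] e

𝟙 : Bool → ℕ
𝟙 true  = 1
𝟙 false = 0

∑-mono : ∀ (p : Subset n) → (∀ {x} → x ∈ p → f x ≤ g x) → ∑ p f ≤ ∑ p g
∑-mono []            f≤g = z≤n
∑-mono (inside  ∷ p) f≤g = +-mono-≤ (f≤g here) (∑-mono p (λ x∈p → f≤g (there x∈p)))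
∑-mono (outside ∷ p) f≤g = ∑-mono p (λ x∈p → f≤g (there x∈p))

∑-cong : ∀ (p : Subset n) → (∀ {x} → x ∈ p → f x ≡ g x) → ∑ p f ≡ ∑ p g
∑-cong p f≡g = ≤-antisym (∑-mono p (λ x∈p → ≤-reflexive (f≡g x∈p)))
                         (∑-mono p (λ x∈p → ≤-reflexive (sym (f≡g x∈p))))

∑-const : ∀ (p : Subset n) c → ∑[ _ ∈ p ] c ≡ ∣ p ∣ * c
∑-const []            c = refl
∑-const (inside  ∷ p) c = cong (c +_) (∑-const p c)
∑-const (outside ∷ p) c = ∑-const p c

∑-Empty : ∀ (p : Subset n) f → Empty p → ∑ p f ≡ 0
∑-Empty p f ∅ = begin
  ∑ p f           ≡⟨ ∑-cong p (λ x∈p → contradiction (_ , x∈p) ∅) ⟩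
  ∑[ _ ∈ p ] 0    ≡⟨ ∑-const p 0 ⟩
  ∣ p ∣ * 0       ≡⟨ *-zeroʳ ∣ p ∣ ⟩
  0               ∎
  where open ≡-Reasoning

∑-distrib-+ : ∀ (p : Subset n) f g → ∑[ x ∈ p ] (f x + g x) ≡ ∑ p f + ∑ p g
∑-distrib-+ []            f g = refl
∑-distrib-+ (inside  ∷ p) f g = begin
  f zero + g zero + ∑[ x ∈ p ] (f (suc x) + g (suc x))
    ≡⟨ cong (f zero + g zero +_) (∑-distrib-+ p _ _) ⟩
  f zero + g zero + (∑[ x ∈ p ] f (suc x) + ∑[ x ∈ p ] g (suc x))
    ≡⟨ interchange (f zero) (g zero) _ _ ⟩
  f zero + ∑[ x ∈ p ] f (suc x) + (g zero + ∑[ x ∈ p ] g (suc x)) ∎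
  where open ≡-Reasoning
∑-distrib-+ (outside ∷ p) f g = ∑-distrib-+ p _ _

∑-distribʳ-* : ∀ (p : Subset n) f c → ∑ p f * c ≡ ∑[ x ∈ p ] (f x * c)
∑-distribʳ-* []            f c = refl
∑-distribʳ-* (inside  ∷ p) f c =
  trans (*-distribʳ-+ c (f zero) _) (cong (f zero * c +_) (∑-distribʳ-* p _ c))
∑-distribʳ-* (outside ∷ p) f c = ∑-distribʳ-* p _ c

∑-remove : ∀ (p : Subset n) f → x ∈ p → ∑ p f ≡ f x + ∑ (p - x) f
∑-remove (inside ∷ p) f here = cong (λ p′ → f zero + ∑ p′ (λ x → f (suc x))) (sym (p─⊥≡p p))
∑-remove {x = suc x} (inside ∷ p) f (there x∈p) = begin
  f zero + ∑[ y ∈ p ] f (suc y)                     ≡⟨ cong (f zero +_) (∑-remove p _ x∈p) ⟩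
  f zero + (f (suc x) + ∑[ y ∈ p - x ] f (suc y))   ≡⟨ x∙yz≈y∙xz (f zero) (f (suc x)) _ ⟩
  f (suc x) + (f zero + ∑[ y ∈ p - x ] f (suc y))   ∎
  where open ≡-Reasoning
∑-remove (outside ∷ p) f (there x∈p) = ∑-remove p _ x∈p

∑-comm : ∀ {m} (p : Subset m) (q : Subset n) (g : Fin m → Fin n → ℕ) →
         ∑[ x ∈ p ] ∑[ y ∈ q ] g x y ≡ ∑[ y ∈ q ] ∑[ x ∈ p ] g x y
∑-comm []            q g = sym (trans (∑-const q 0) (*-zeroʳ ∣ q ∣))
∑-comm (inside  ∷ p) q g = begin
  ∑[ y ∈ q ] g zero y + ∑[ x ∈ p ] ∑[ y ∈ q ] g (suc x) y
    ≡⟨ cong (∑[ y ∈ q ] g zero y +_) (∑-comm p q _) ⟩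
  ∑[ y ∈ q ] g zero y + ∑[ y ∈ q ] ∑[ x ∈ p ] g (suc x) y
    ≡⟨ ∑-distrib-+ q _ _ ⟨
  ∑[ y ∈ q ] (g zero y + ∑[ x ∈ p ] g (suc x) y) ∎
  where open ≡-Reasoning
∑-comm (outside ∷ p) q g = ∑-comm p q _

∑-∁ : ∀ (p : Subset n) f → ∑ p f + ∑ (∁ p) f ≡ ∑ ⊤ f
∑-∁ []            f = refl
∑-∁ (inside  ∷ p) f = trans (+-assoc (f zero) _ _) (cong (f zero +_) (∑-∁ p _))
∑-∁ (outside ∷ p) f = trans (x∙yz≈y∙xz (∑ p _) (f zero) _) (cong (f zero +_) (∑-∁ p _))

∣p∩q∣≡∑𝟙 : ∀ (p q : Subset n) → ∣ p ∩ q ∣ ≡ ∑[ y ∈ q ] 𝟙 (lookup p y)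
∣p∩q∣≡∑𝟙 []            []            = refl
∣p∩q∣≡∑𝟙 (inside  ∷ p) (inside  ∷ q) = cong suc (∣p∩q∣≡∑𝟙 p q)
∣p∩q∣≡∑𝟙 (outside ∷ p) (inside  ∷ q) = ∣p∩q∣≡∑𝟙 p q
∣p∩q∣≡∑𝟙 (inside  ∷ p) (outside ∷ q) = ∣p∩q∣≡∑𝟙 p q
∣p∩q∣≡∑𝟙 (outside ∷ p) (outside ∷ q) = ∣p∩q∣≡∑𝟙 p q

∣p∣≡1+∣p-x∣ : ∀ (p : Subset n) → x ∈ p → ∣ p ∣ ≡ suc ∣ p - x ∣
∣p∣≡1+∣p-x∣ {x = x} p x∈p = begin
  ∣ p ∣                 ≡⟨ *-identityʳ ∣ p ∣ ⟨
  ∣ p ∣ * 1             ≡⟨ ∑-const p 1 ⟨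
  ∑[ _ ∈ p ] 1          ≡⟨ ∑-remove p _ x∈p ⟩
  1 + ∑[ _ ∈ p - x ] 1  ≡⟨ cong suc (trans (∑-const (p - x) 1) (*-identityʳ _)) ⟩
  suc ∣ p - x ∣         ∎
  where open ≡-Reasoning

x∉p-x : ∀ (p : Subset n) → x ∉ p - x
x∉p-x {x = suc x} (_ ∷ p) (there x∈p-x) = x∉p-x p x∈p-x

x∉p⇒∣p∣<∣p∪⁅x⁆∣ : x ∉ p → ∣ p ∣ < ∣ p ∪ ⁅ x ⁆ ∣
x∉p⇒∣p∣<∣p∪⁅x⁆∣ {x = x} {p = p} x∉p =
  ≤-<-trans (p⊆q⇒∣p∣≤∣q∣ p⊆p∪⁅x⁆-x) (x∈p⇒∣p-x∣<∣p∣ (q⊆p∪q p ⁅ x ⁆ (x∈⁅x⁆ x)))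
  where
  p⊆p∪⁅x⁆-x : p ⊆ p ∪ ⁅ x ⁆ - x
  p⊆p∪⁅x⁆-x y∈p = x∈p∧x≢y⇒x∈p-y (p⊆p∪q ⁅ x ⁆ y∈p) (λ { refl → x∉p y∈p })

∃-argmax : ∀ (f : Fin n → ℕ) (p : Subset n) → Nonempty p →
           ∃ λ v → v ∈ p × (∀ {x} → x ∈ p → f x ≤ f v)
∃-argmax f (inside ∷ p) _ with nonempty? p
... | no ∅ = zero , here , λ { here → ≤-refl ; (there x∈p) → contradiction (_ , x∈p) ∅ }
... | yes ne with ∃-argmax (λ x → f (suc x)) p ne
...   | v , v∈p , v-max with f zero ≤? f (suc v)
...     | yes f0≤fv = suc v , there v∈p , λ { here → f0≤fv ; (there x∈p) → v-max x∈p }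
...     | no  f0≰fv = zero , here , λ { here → ≤-refl ; (there x∈p) → ≤-trans (v-max x∈p) (≰⇒≥ f0≰fv) }
∃-argmax f (outside ∷ p) (suc x , there x∈p) with ∃-argmax (λ x → f (suc x)) p (x , x∈p)
... | v , v∈p , v-max = suc v , there v∈p , λ { (there x∈p) → v-max x∈p }

p∪⁅x⁆⊆q : ∀ {p q : Subset n} → p ⊆ q → x ∈ q → p ∪ ⁅ x ⁆ ⊆ q
p∪⁅x⁆⊆q {x = x} {p} p⊆q x∈q y∈p∪⁅x⁆ with x∈p∪q⁻ p ⁅ x ⁆ y∈p∪⁅x⁆
... | inj₁ y∈p = p⊆q y∈p
... | inj₂ y∈⁅x⁆ rewrite x∈⁅y⁆⇒x≡y x y∈⁅x⁆ = x∈q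

d+[d+D]≤2k*s : ∀ {k d D s} → d ≤ k → d ≤ s → D ≤ 2 * k * (s ∸ 1) → d + (d + D) ≤ 2 * k * s
d+[d+D]≤2k*s {s = zero}  _   z≤n D≤0 = D≤0
d+[d+D]≤2k*s {k} {s = suc s} d≤k _ D≤ = ≤-trans (+-mono-≤ d≤k (+-mono-≤ d≤k D≤)) (≤-reflexive (expand k s))
  where
  expand : ∀ k s → k + (k + 2 * k * s) ≡ 2 * k * suc s
  expand = solve-∀

module Weight (k r : ℕ) where

  -- R = (r+1)! makes weight d = R(k+1)/(max(d,k)+1) an integer, and makes the divisions in
  -- share j = R/(j+1) (j ≤ r) and gap a = R/((a+1)(a+2)) = share a − share (a+1) exact.
  R : ℕ
  R = suc r !

  instance
    R≢0 : NonZero R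
    R≢0 = suc r !≢0

  share : ℕ → ℕ
  share j = R / suc j

  gap : ℕ → ℕ
  gap a = R / (suc a * suc (suc a))

  share-* : ∀ {j} → j ≤ r → share j * suc j ≡ R
  share-* {j} j≤r = m/n*n≡m (∣-trans (m∣m*n (j !)) (m≤n⇒m!∣n! (s≤s j≤r)))

  gap-* : ∀ {a} → suc a ≤ r → gap a * (suc a * suc (suc a)) ≡ R
  gap-* {a} 1+a≤r = m/n*n≡m (∣-trans (divides (a !) (unfold-! a (a !))) (m≤n⇒m!∣n! (s≤s 1+a≤r)))
    where
    unfold-! : ∀ a f → suc (suc a) * (suc a * f) ≡ f * (suc a * suc (suc a))
    unfold-! = solve-∀

  share-suc+gap : ∀ {e} → suc e ≤ r → share (suc e) + gap e ≡ share e
  share-suc+gap {e} 1+e≤r = *-cancelʳ-≡ _ _ (suc e * suc (suc e)) (begin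
    (share (suc e) + gap e) * (suc e * suc (suc e))
      ≡⟨ expand (share (suc e)) (gap e) e ⟩
    share (suc e) * suc (suc e) * suc e + gap e * (suc e * suc (suc e))
      ≡⟨ cong₂ (λ a b → a * suc e + b) (share-* 1+e≤r) (gap-* 1+e≤r) ⟩
    R * suc e + R
      ≡⟨ +-comm (R * suc e) R ⟩
    R + R * suc e
      ≡⟨ *-suc R (suc e) ⟨
    R * suc (suc e)
      ≡⟨ cong (_* suc (suc e)) (share-* (<⇒≤ 1+e≤r)) ⟨
    share e * suc e * suc (suc e)
      ≡⟨ *-assoc (share e) (suc e) (suc (suc e)) ⟩
    share e * (suc e * suc (suc e)) ∎)
    where
    open ≡-Reasoning
    expand : ∀ x y e → (x + y) * (suc e * suc (suc e)) ≡ x * suc (suc e) * suc e + y * (suc e * suc (suc e))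
    expand = solve-∀

  share-suc : ∀ {a} → suc a ≤ r → share (suc a) ≡ suc a * gap a
  share-suc {a} 1+a≤r = *-cancelʳ-≡ _ _ (suc (suc a)) (begin
    share (suc a) * suc (suc a)     ≡⟨ share-* 1+a≤r ⟩
    R                               ≡⟨ gap-* 1+a≤r ⟨
    gap a * (suc a * suc (suc a))   ≡⟨ regroup (gap a) a ⟩
    suc a * gap a * suc (suc a)     ∎)
    where
    open ≡-Reasoning
    regroup : ∀ x a → x * (suc a * suc (suc a)) ≡ suc a * x * suc (suc a)
    regroup = solve-∀

  weight : ℕ → ℕ
  weight d = suc k * share (d ⊔ k)

  weight-antitone : ∀ {d d′} → d ≤ d′ → weight d′ ≤ weight d
  weight-antitone d≤d′ = *-monoʳ-≤ (suc k) (/-monoʳ-≤ R (s≤s (⊔-monoˡ-≤ k d≤d′)))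

  weight-low : ∀ {d} → k ≤ r → d ≤ k → weight d ≡ R
  weight-low k≤r d≤k rewrite m≤n⇒m⊔n≡n d≤k = trans (*-comm (suc k) (share k)) (share-* k≤r)

  weight-top : k ≤ r → weight r * suc r ≡ suc k * R
  weight-top k≤r rewrite m≥n⇒m⊔n≡m k≤r =
    trans (*-assoc (suc k) (share r) (suc r)) (cong (suc k *_) (share-* ≤-refl))

  weight-step : ∀ {e a} → k ≤ e → e ≤ a → suc a ≤ r → weight (suc e) + suc k * gap a ≤ weight e
  weight-step {e} {a} k≤e e≤a 1+a≤r
    rewrite m≥n⇒m⊔n≡m (m≤n⇒m≤1+n k≤e) | m≥n⇒m⊔n≡m k≤e = begin
      suc k * share (suc e) + suc k * gap a   ≡⟨ *-distribˡ-+ (suc k) (share (suc e)) (gap a) ⟨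
      suc k * (share (suc e) + gap a)         ≤⟨ *-monoʳ-≤ (suc k) (+-monoʳ-≤ (share (suc e)) gap-antitone) ⟩
      suc k * (share (suc e) + gap e)         ≡⟨ cong (suc k *_) (share-suc+gap (≤-trans (s≤s e≤a) 1+a≤r)) ⟩
      suc k * share e                         ∎
    where
    open ≤-Reasoning
    gap-antitone : gap a ≤ gap e
    gap-antitone = /-monoʳ-≤ R (*-mono-≤ (s≤s e≤a) (s≤s (s≤s e≤a)))

  weight-split : ∀ {a} → k ≤ suc a → suc a ≤ r → weight (suc a) ≡ suc a * (suc k * gap a)
  weight-split {a} k≤1+a 1+a≤r rewrite m≥n⇒m⊔n≡m k≤1+a =
    trans (cong (suc k *_) (share-suc 1+a≤r)) (x*yz≡y*xz (suc k) (suc a) (gap a))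

  weight-step-𝟙 : ∀ {a d e} b → d ≡ 𝟙 b + e → k < d → d ≤ suc a → suc a ≤ r →
                  weight d + 𝟙 b * (suc k * gap a) ≤ weight e
  weight-step-𝟙 false refl _ _ _ = ≤-reflexive (+-identityʳ _)
  weight-step-𝟙 {a} {e = e} true refl (s≤s k≤e) (s≤s e≤a) 1+a≤r =
    subst (λ c → weight (suc e) + c ≤ weight e) (sym (*-identityˡ (suc k * gap a)))
          (weight-step k≤e e≤a 1+a≤r)

  weight-top-bound : ∀ {n s} → k ≤ r → n * weight r ≤ R * s → suc k * n ≤ suc r * s
  weight-top-bound {n} {s} k≤r bound = *-cancelʳ-≤ (suc k * n) (suc r * s) R (begin
    suc k * n * R           ≡⟨ rearrangeˡ (suc k) n R ⟩
    n * (suc k * R)         ≡⟨ cong (n *_) (weight-top k≤r) ⟨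
    n * (weight r * suc r)  ≡⟨ *-assoc n (weight r) (suc r) ⟨
    n * weight r * suc r    ≤⟨ *-monoˡ-≤ (suc r) bound ⟩
    R * s * suc r           ≡⟨ rearrangeʳ R s (suc r) ⟩
    suc r * s * R           ∎)
    where
    open ≤-Reasoning
    rearrangeˡ : ∀ a b c → a * b * c ≡ b * (a * c)
    rearrangeˡ = solve-∀
    rearrangeʳ : ∀ a b c → a * b * c ≡ c * b * a
    rearrangeʳ = solve-∀

upper-bound-arith : ∀ {k r n s c} → k < r → r < n → s + c ≡ n →
                    r * s ≤ 2 * k * (s ∸ 1) + r * c → 2 * r * s + 2 * k ≤ r * n + 2 * k * s
upper-bound-arith {k} {r} {n} {zero} k<r r<n _ _ = begin
  2 * r * 0 + 2 * k   ≡⟨ cong (_+ 2 * k) (*-zeroʳ (2 * r)) ⟩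
  2 * k               ≤⟨ *-monoʳ-≤ 2 (<⇒≤ k<r) ⟩
  2 * r               ≡⟨ *-comm 2 r ⟩
  r * 2               ≤⟨ *-monoʳ-≤ r (≤-trans (s≤s (≤-<-trans z≤n k<r)) r<n) ⟩
  r * n               ≡⟨ +-identityʳ (r * n) ⟨
  r * n + 0           ≡⟨ cong (r * n +_) (*-zeroʳ (2 * k)) ⟨
  r * n + 2 * k * 0   ∎
  where open ≤-Reasoning
upper-bound-arith {k} {r} {s = suc s} {c} _ _ refl r[1+s]≤ = begin
  2 * r * suc s + 2 * k                    ≡⟨ double r k s ⟩
  r * suc s + r * suc s + 2 * k            ≤⟨ +-monoˡ-≤ (2 * k) (+-monoʳ-≤ (r * suc s) r[1+s]≤) ⟩
  r * suc s + (2 * k * s + r * c) + 2 * k  ≡⟨ regroup r k s c ⟩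
  r * (suc s + c) + 2 * k * suc s          ∎
  where
  open ≤-Reasoning
  double : ∀ r k s → 2 * r * suc s + 2 * k ≡ r * suc s + r * suc s + 2 * k
  double = solve-∀
  regroup : ∀ r k s c → r * suc s + (2 * k * s + r * c) + 2 * k ≡ r * (suc s + c) + 2 * k * suc s
  regroup = solve-∀

module _ (G : SimpleGraph n) where

  degreeIn : Subset n → Fin n → ℕ
  degreeIn T v = ∣ N G v ∩ T ∣

  degreeIn≡∑ : ∀ T v → degreeIn T v ≡ ∑[ y ∈ T ] 𝟙 (adj G v y)
  degreeIn≡∑ T v = trans (∣p∩q∣≡∑𝟙 (N G v) T) (∑-cong T (λ {y} _ → cong 𝟙 (lookup∘tabulate (adj G v) y)))

  ∑𝟙adj≡degreeIn : ∀ T v → ∑[ x ∈ T ] 𝟙 (adj G x v) ≡ degreeIn T v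
  ∑𝟙adj≡degreeIn T v = trans (∑-cong T (λ {x} _ → cong 𝟙 (symm G x v))) (sym (degreeIn≡∑ T v))

  degreeIn-mono : ∀ {T U} v → T ⊆ U → degreeIn T v ≤ degreeIn U v
  degreeIn-mono {T} {U} v T⊆U = p⊆q⇒∣p∣≤∣q∣ {p = N G v ∩ T} {q = N G v ∩ U} λ y∈N∩T →
    let y∈N , y∈T = x∈p∩q⁻ _ _ y∈N∩T in x∈p∩q⁺ (y∈N , T⊆U y∈T)

  degreeIn≤degree : ∀ T v → degreeIn T v ≤ degree G v
  degreeIn≤degree T v = ∣p∩q∣≤∣p∣ (N G v) T

  degreeIn-⊤ : ∀ v → degreeIn ⊤ v ≡ degree G v
  degreeIn-⊤ v = cong ∣_∣ (∩-identityʳ (N G v))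

  degreeIn+degreeIn-∁ : ∀ T v → degreeIn T v + degreeIn (∁ T) v ≡ degree G v
  degreeIn+degreeIn-∁ T v = begin
    degreeIn T v + degreeIn (∁ T) v
      ≡⟨ cong₂ _+_ (degreeIn≡∑ T v) (degreeIn≡∑ (∁ T) v) ⟩
    ∑[ y ∈ T ] 𝟙 (adj G v y) + ∑[ y ∈ ∁ T ] 𝟙 (adj G v y)
      ≡⟨ ∑-∁ T _ ⟩
    ∑[ y ∈ ⊤ ] 𝟙 (adj G v y)
      ≡⟨ degreeIn≡∑ ⊤ v ⟨
    degreeIn ⊤ v
      ≡⟨ degreeIn-⊤ v ⟩
    degree G v ∎
    where open ≡-Reasoning

  degreeIn-remove : ∀ {T u} x → u ∈ T → degreeIn T x ≡ 𝟙 (adj G x u) + degreeIn (T - u) x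
  degreeIn-remove {T} {u} x u∈T = begin
    degreeIn T x                                ≡⟨ degreeIn≡∑ T x ⟩
    ∑[ y ∈ T ] 𝟙 (adj G x y)                    ≡⟨ ∑-remove T _ u∈T ⟩
    𝟙 (adj G x u) + ∑[ y ∈ T - u ] 𝟙 (adj G x y) ≡⟨ cong (𝟙 (adj G x u) +_) (degreeIn≡∑ (T - u) x) ⟨
    𝟙 (adj G x u) + degreeIn (T - u) x          ∎
    where open ≡-Reasoning

  degreeIn-remove-self : ∀ {T v} → v ∈ T → degreeIn T v ≡ degreeIn (T - v) v
  degreeIn-remove-self {T} {v} v∈T =
    trans (degreeIn-remove v v∈T) (cong (λ b → 𝟙 b + degreeIn (T - v) v) (irrefl G v))

  ∑degreeIn-comm : ∀ S T → ∑[ x ∈ S ] degreeIn T x ≡ ∑[ y ∈ T ] degreeIn S y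
  ∑degreeIn-comm S T = begin
    ∑[ x ∈ S ] degreeIn T x                 ≡⟨ ∑-cong S (λ {x} _ → degreeIn≡∑ T x) ⟩
    ∑[ x ∈ S ] ∑[ y ∈ T ] 𝟙 (adj G x y)     ≡⟨ ∑-comm S T _ ⟩
    ∑[ y ∈ T ] ∑[ x ∈ S ] 𝟙 (adj G x y)     ≡⟨ ∑-cong T (λ {y} _ → ∑𝟙adj≡degreeIn S y) ⟩
    ∑[ y ∈ T ] degreeIn S y                 ∎
    where open ≡-Reasoning

  degree<n : ∀ v → degree G v < n
  degree<n v = begin-strict
    ∣ N G v ∣      ≤⟨ p⊆q⇒∣p∣≤∣q∣ N⊆⊤-v ⟩
    ∣ ⊤ - v ∣      <⟨ x∈p⇒∣p-x∣<∣p∣ (∈⊤ {x = v}) ⟩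
    ∣ ⊤ {n} ∣      ≡⟨ ∣⊤∣≡n n ⟩
    n              ∎
    where
    open ≤-Reasoning
    N⊆⊤-v : N G v ⊆ ⊤ - v
    N⊆⊤-v {y} y∈N = x∈p∧x≢y⇒x∈p-y ∈⊤ λ { refl → no-loop ([]=⇒lookup y∈N) }
      where
      no-loop : lookup (N G v) v ≢ true
      no-loop loop with () ← trans (sym loop) (trans (lookup∘tabulate (adj G v) v) (irrefl G v))

  degenerate-⊆ : ∀ {k S S′} → S′ ⊆ S → InducedDegenerate k G S → InducedDegenerate k G S′
  degenerate-⊆ S′⊆S degS T T⊆S′ = degS T (λ x∈T → S′⊆S (T⊆S′ x∈T))

  degenerate-∪⁅⁆ : ∀ {k S U u} → S ⊆ U → u ∈ U → degreeIn U u ≤ k →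
                   InducedDegenerate k G S → InducedDegenerate k G (S ∪ ⁅ u ⁆)
  degenerate-∪⁅⁆ {S = S} {U} {u} S⊆U u∈U u-low degS T T⊆S∪u T≢∅ with u ∈? T
  ... | yes u∈T = u , u∈T , ≤-trans (degreeIn-mono u (λ y∈T → p∪⁅x⁆⊆q S⊆U u∈U (T⊆S∪u y∈T))) u-low
  ... | no  u∉T = degS T T⊆S T≢∅
    where
    T⊆S : T ⊆ S
    T⊆S y∈T with x∈p∪q⁻ S ⁅ u ⁆ (T⊆S∪u y∈T)
    ... | inj₁ y∈S   = y∈S
    ... | inj₂ y∈⁅u⁆ rewrite x∈⁅y⁆⇒x≡y u y∈⁅u⁆ = contradiction y∈T u∉T

  ∑degreeIn≤ : ∀ {k} S → InducedDegenerate k G S → ∑[ x ∈ S ] degreeIn S x ≤ 2 * k * (∣ S ∣ ∸ 1)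
  ∑degreeIn≤ {k} S = go S (⊂-wellFounded S)
    where
    go : ∀ S → Acc _⊂_ S → InducedDegenerate k G S → ∑[ x ∈ S ] degreeIn S x ≤ 2 * k * (∣ S ∣ ∸ 1)
    go S (acc rec) degS with nonempty? S
    ... | no ∅ = ≤-trans (≤-reflexive (∑-Empty S _ ∅)) z≤n
    ... | yes S≢∅ with degS S (λ x∈S → x∈S) S≢∅
    ...   | v , v∈S , v-low = begin
      ∑[ x ∈ S ] degreeIn S x
        ≡⟨ ∑-remove S _ v∈S ⟩
      degreeIn S v + ∑[ x ∈ S′ ] degreeIn S x
        ≡⟨ cong₂ _+_ (degreeIn-remove-self v∈S) (∑-cong S′ (λ {x} _ → degreeIn-remove x v∈S)) ⟩
      d + ∑[ x ∈ S′ ] (𝟙 (adj G x v) + degreeIn S′ x)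
        ≡⟨ cong (d +_) (∑-distrib-+ S′ _ _) ⟩
      d + (∑[ x ∈ S′ ] 𝟙 (adj G x v) + ∑[ x ∈ S′ ] degreeIn S′ x)
        ≡⟨ cong (λ d′ → d + (d′ + ∑[ x ∈ S′ ] degreeIn S′ x)) (∑𝟙adj≡degreeIn S′ v) ⟩
      d + (d + ∑[ x ∈ S′ ] degreeIn S′ x)
        ≤⟨ d+[d+D]≤2k*s d≤k (∣p∩q∣≤∣q∣ (N G v) S′) (go S′ (rec (x∈p⇒p-x⊂p v∈S)) degS′) ⟩
      2 * k * ∣ S′ ∣
        ≡⟨ cong (λ s → 2 * k * (s ∸ 1)) (∣p∣≡1+∣p-x∣ S v∈S) ⟨
      2 * k * (∣ S ∣ ∸ 1) ∎
      where
      open ≤-Reasoning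
      S′ = S - v
      d = degreeIn S′ v
      d≤k : d ≤ k
      d≤k = subst (_≤ k) (degreeIn-remove-self v∈S) v-low
      degS′ : InducedDegenerate k G S′
      degS′ = degenerate-⊆ (p─q⊆p S ⁅ v ⁆) degS

  module _ (k r : ℕ) where
    open Weight k r

    potential : Subset n → ℕ
    potential U = ∑[ x ∈ U ] weight (degreeIn U x)

    potential-remove-low : ∀ {U u} → k ≤ r → u ∈ U → degreeIn U u ≤ k → potential U ≤ R + potential (U - u)
    potential-remove-low {U} {u} k≤r u∈U u-low = begin
      potential U
        ≡⟨ ∑-remove U _ u∈U ⟩
      weight (degreeIn U u) + ∑[ x ∈ U - u ] weight (degreeIn U x)
        ≤⟨ +-mono-≤ (≤-reflexive (weight-low k≤r u-low))
                    (∑-mono (U - u) (λ {x} _ → weight-antitone (degreeIn-mono x (p─q⊆p U ⁅ u ⁆)))) ⟩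
      R + potential (U - u) ∎
      where open ≤-Reasoning

    potential-remove-max : ∀ {U v} → (∀ v → degree G v ≤ r) → (∀ {x} → x ∈ U → k < degreeIn U x) → v ∈ U →
                           (∀ {x} → x ∈ U → degreeIn U x ≤ degreeIn U v) → potential U ≤ potential (U - v)
    potential-remove-max {U} {v} Δ≤r high v∈U v-max with degreeIn U v in Δ≡
    ... | zero  = contradiction (subst (k <_) Δ≡ (high v∈U)) n≮0
    ... | suc a = begin
      potential U
        ≡⟨ ∑-remove U _ v∈U ⟩
      weight (degreeIn U v) + ∑[ x ∈ U′ ] weight (degreeIn U x)
        ≡⟨ cong (_+ ∑[ x ∈ U′ ] weight (degreeIn U x)) weight-Δ ⟩
      ∑[ x ∈ U′ ] (𝟙 (adj G x v) * c) + ∑[ x ∈ U′ ] weight (degreeIn U x)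
        ≡⟨ +-comm (∑[ x ∈ U′ ] (𝟙 (adj G x v) * c)) _ ⟩
      ∑[ x ∈ U′ ] weight (degreeIn U x) + ∑[ x ∈ U′ ] (𝟙 (adj G x v) * c)
        ≡⟨ ∑-distrib-+ U′ _ _ ⟨
      ∑[ x ∈ U′ ] (weight (degreeIn U x) + 𝟙 (adj G x v) * c)
        ≤⟨ ∑-mono U′ neighbour-gain ⟩
      potential U′ ∎
      where
      open ≤-Reasoning
      U′ = U - v
      c = suc k * gap a
      1+a≤r : suc a ≤ r
      1+a≤r = subst (_≤ r) Δ≡ (≤-trans (degreeIn≤degree U v) (Δ≤r v))
      neighbours : ∑[ x ∈ U′ ] 𝟙 (adj G x v) ≡ suc a
      neighbours = trans (∑𝟙adj≡degreeIn U′ v) (trans (sym (degreeIn-remove-self v∈U)) Δ≡)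
      weight-Δ : weight (degreeIn U v) ≡ ∑[ x ∈ U′ ] (𝟙 (adj G x v) * c)
      weight-Δ = begin-equality
        weight (degreeIn U v)          ≡⟨ cong weight Δ≡ ⟩
        weight (suc a)                 ≡⟨ weight-split (<⇒≤ (subst (k <_) Δ≡ (high v∈U))) 1+a≤r ⟩
        suc a * c                      ≡⟨ cong (_* c) neighbours ⟨
        ∑[ x ∈ U′ ] 𝟙 (adj G x v) * c  ≡⟨ ∑-distribʳ-* U′ _ c ⟩
        ∑[ x ∈ U′ ] (𝟙 (adj G x v) * c) ∎
      neighbour-gain : ∀ {x} → x ∈ U′ → weight (degreeIn U x) + 𝟙 (adj G x v) * c ≤ weight (degreeIn U′ x)
      neighbour-gain {x} x∈U′ = weight-step-𝟙 (adj G x v) (degreeIn-remove x v∈U) (high x∈U)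
                                  (v-max x∈U) 1+a≤r
        where x∈U = p─q⊆p U ⁅ v ⁆ x∈U′

    degenerate-subset : (∀ v → degree G v ≤ r) → k ≤ r →
                        ∀ U → ∃ λ S → S ⊆ U × InducedDegenerate k G S × potential U ≤ R * ∣ S ∣
    degenerate-subset Δ≤r k≤r U = go U (⊂-wellFounded U)
      where
      go : ∀ U → Acc _⊂_ U → ∃ λ S → S ⊆ U × InducedDegenerate k G S × potential U ≤ R * ∣ S ∣
      go U (acc rec) with any? (λ u → u ∈? U ×-dec degreeIn U u ≤? k)
      ... | yes (u , u∈U , u-low) with go (U - u) (rec (x∈p⇒p-x⊂p u∈U))
      ...   | S , S⊆U-u , degS , bound =
        S ∪ ⁅ u ⁆ , p∪⁅x⁆⊆q S⊆U u∈U , degenerate-∪⁅⁆ S⊆U u∈U u-low degS , (begin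
          potential U           ≤⟨ potential-remove-low k≤r u∈U u-low ⟩
          R + potential (U - u) ≤⟨ +-monoʳ-≤ R bound ⟩
          R + R * ∣ S ∣         ≡⟨ *-suc R ∣ S ∣ ⟨
          R * suc ∣ S ∣         ≤⟨ *-monoʳ-≤ R (x∉p⇒∣p∣<∣p∪⁅x⁆∣ (λ u∈S → x∉p-x U (S⊆U-u u∈S))) ⟩
          R * ∣ S ∪ ⁅ u ⁆ ∣     ∎)
        where
        open ≤-Reasoning
        S⊆U : S ⊆ U
        S⊆U x∈S = p─q⊆p U ⁅ u ⁆ (S⊆U-u x∈S)
      go U (acc rec) | no no-low with nonempty? U
      ... | no ∅ = U , (λ x∈U → x∈U) , (λ T T⊆U (x , x∈T) → contradiction (x , T⊆U x∈T) ∅) ,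
                   ≤-trans (≤-reflexive (∑-Empty U _ ∅)) z≤n
      ... | yes U≢∅ with ∃-argmax (degreeIn U) U U≢∅
      ...   | v , v∈U , v-max with go (U - v) (rec (x∈p⇒p-x⊂p v∈U))
      ...     | S , S⊆U-v , degS , bound =
        S , (λ x∈S → p─q⊆p U ⁅ v ⁆ (S⊆U-v x∈S)) , degS ,
        ≤-trans (potential-remove-max Δ≤r high v∈U v-max) bound
        where
        high : ∀ {x} → x ∈ U → k < degreeIn U x
        high x∈U = ≰⇒> (λ x-low → no-low (_ , x∈U , x-low))

    potential-⊤ : Regular r G → potential (⊤ {n}) ≡ n * weight r
    potential-⊤ regular = begin
      potential ⊤              ≡⟨ ∑-cong (⊤ {n}) (λ {x} _ → cong weight (trans (degreeIn-⊤ x) (regular x))) ⟩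
      ∑[ _ ∈ ⊤ {n} ] weight r  ≡⟨ ∑-const (⊤ {n}) (weight r) ⟩
      ∣ ⊤ {n} ∣ * weight r     ≡⟨ cong (_* weight r) (∣⊤∣≡n n) ⟩
      n * weight r             ∎
      where open ≡-Reasoning

  ∑degreeIn≤r*∣T∣ : ∀ {r} → (∀ v → degree G v ≤ r) → ∀ S T → ∑[ x ∈ S ] degreeIn T x ≤ r * ∣ T ∣
  ∑degreeIn≤r*∣T∣ {r} Δ≤r S T = begin
    ∑[ x ∈ S ] degreeIn T x   ≡⟨ ∑degreeIn-comm S T ⟩
    ∑[ y ∈ T ] degreeIn S y   ≤⟨ ∑-mono T (λ {y} _ → ≤-trans (degreeIn≤degree S y) (Δ≤r y)) ⟩
    ∑[ _ ∈ T ] r              ≡⟨ ∑-const T r ⟩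
    ∣ T ∣ * r                 ≡⟨ *-comm ∣ T ∣ r ⟩
    r * ∣ T ∣                 ∎
    where open ≤-Reasoning

  regular-degenerate-bound : ∀ {k r S} → Regular r G → InducedDegenerate k G S →
                             r * ∣ S ∣ ≤ 2 * k * (∣ S ∣ ∸ 1) + r * ∣ ∁ S ∣
  regular-degenerate-bound {k} {r} {S} regular degS = begin
    r * ∣ S ∣
      ≡⟨ *-comm r ∣ S ∣ ⟩
    ∣ S ∣ * r
      ≡⟨ ∑-const S r ⟨
    ∑[ _ ∈ S ] r
      ≡⟨ ∑-cong S (λ {x} _ → trans (sym (regular x)) (sym (degreeIn+degreeIn-∁ S x))) ⟩
    ∑[ x ∈ S ] (degreeIn S x + degreeIn (∁ S) x)
      ≡⟨ ∑-distrib-+ S _ _ ⟩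
    ∑[ x ∈ S ] degreeIn S x + ∑[ x ∈ S ] degreeIn (∁ S) x
      ≤⟨ +-mono-≤ (∑degreeIn≤ S degS) (∑degreeIn≤r*∣T∣ (λ v → ≤-reflexive (regular v)) S (∁ S)) ⟩
    2 * k * (∣ S ∣ ∸ 1) + r * ∣ ∁ S ∣ ∎
    where open ≤-Reasoning

theorem9 : ∀ (n r k : ℕ) (G : SimpleGraph n) → 1 ≤ n → Regular r G → k < r →
    (∃ λ (S : Subset n) → InducedDegenerate k G S × suc k * n ≤ suc r * ∣ S ∣)
    × (∀ (S : Subset n) → InducedDegenerate k G S → 2 * r * ∣ S ∣ + 2 * k ≤ r * n + 2 * k * ∣ S ∣)
theorem9 n r k G 1≤n regular k<r = lower , upper
  where
  Δ≤r : ∀ v → degree G v ≤ r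
  Δ≤r v = ≤-reflexive (regular v)
  k≤r = <⇒≤ k<r

  lower : ∃ λ S → InducedDegenerate k G S × suc k * n ≤ suc r * ∣ S ∣
  lower with degenerate-subset G k r Δ≤r k≤r ⊤
  ... | S , _ , degS , bound =
    S , degS , Weight.weight-top-bound k r k≤r (subst (_≤ _) (potential-⊤ G k r regular) bound)

  upper : ∀ S → InducedDegenerate k G S → 2 * r * ∣ S ∣ + 2 * k ≤ r * n + 2 * k * ∣ S ∣
  upper S degS = upper-bound-arith k<r r<n ∣S∣+∣∁S∣≡n (regular-degenerate-bound G regular degS)
    where
    r<n : r < n
    r<n = subst (_< n) (regular (fromℕ< 1≤n)) (degree<n G (fromℕ< 1≤n))
    ∣S∣+∣∁S∣≡n : ∣ S ∣ + ∣ ∁ S ∣ ≡ n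
    ∣S∣+∣∁S∣≡n = trans (cong (∣ S ∣ +_) (∣∁p∣≡n∸∣p∣ S)) (m+[n∸m]≡n (∣p∣≤n S))
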